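{- Let $C=(I,V,E,O)$ be a CDAG and let $S\ge 1$ be the number of red pebbles. Let $\{V_1,\dots,V_p\}$ be an arbitrary (not necessarily acyclic) partition of $V$ into pairwise disjoint sets with $\bigcup_{i=1}^p V_i=V$, and let $C_1,\dots,C_p$ be the induced sub-CDAGs $C_i=(I_i,V_i,E_i,O_i)$ with $I_i=I\cap V_i$, $E_i=E\cap(V_i\times V_i)$, $O_i=O\cap V_i$. If $Q$ is the I/O complexity of $C$ and $Q_i$ is the I/O complexity of $C_i$ (all with $S$ red pebbles, in the red-blue pebble game with flexible input/output labeling described in the context), then $\sum_{i=1}^p Q_i\le Q$. In particular, if $L_i$ is an I/O lower bound for $C_i$ for each $i$, then $\sum_{i=1}^p L_i$ is an I/O lower bound for $C$.
   Context: A CDAG (computational directed acyclic graph) is a 4-tuple $C=(I,V,E,O)$ of finite sets such that $E\subseteq V\times V$, $(V,E)$ is a directed acyclic graph, $I\subseteq V$ (the input set) consists of vertices with no incoming edges, and $O\subseteq V$ is the output set. (Flexible labeling: vertices with no predecessors need not belong to $I$, and vertices with no successors need not belong to $O$.) Red-blue pebble game with flexible input/output labeling: given $S$ red pebbles and arbitrarily many blue pebbles, start with a blue pebble on each vertex of $I$ and no other pebbles. Allowed moves: R1 (input) place a red pebble on any vertex carrying a blue pebble; R2 (output) place a blue pebble on any vertex carrying a red pebble; R3 (compute) if all immediate predecessors of a vertex $v\in V\setminus I$ carry red pebbles (vacuously true if $v$ has no predecessors), a red pebble may be placed on (or moved from a predecessor to) $v$; R4 (delete) remove a red pebble from any vertex.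 At no time may more than $S$ red pebbles be on the graph. A complete calculation is a finite sequence of moves in which every vertex of $V\setminus I$ is fired (receives a red pebble by R3) at least once and which ends with blue pebbles on all vertices of $O$. Its cost is the number of R1 and R2 moves. The I/O complexity of $C$ is the minimum cost over all complete calculations; an I/O lower bound is any number not exceeding it. -}

module Defs where

open import Data.Nat using (ℕ; _≤_; _+_)
open import Data.Bool using (Bool; true; false; T; _∧_)
open import Data.Fin using (Fin; _≟_)
open import Data.Fin.Subset using (Subset; _∈_; _∉_; ⊥; _∩_; ∣_∣; inside; outside)
open import Data.Vec using (Vec; lookup; tabulate; _[_]≔_)
open import Data.Product using (Σ; _×_)
open import Relation.Nullary using (¬_)
open import Relation.Nullary.Decidable using (⌊_⌋)
open import Relation.Binary.Construct.Closure.Transitive using (TransClosure)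

-- Vertices live in the universe Fin n; the actual vertex set is a subset V.
-- Edges are given by a Boolean adjacency function.
record RawCDAG (n : ℕ) : Set where
  constructor mkRaw
  field
    V : Subset n
    E : Fin n → Fin n → Bool
    I : Subset n
    O : Subset n

Edge : ∀ {n} → RawCDAG n → Fin n → Fin n → Set
Edge G u v = T (RawCDAG.E G u v)

record IsCDAG {n : ℕ} (G : RawCDAG n) : Set where
  open RawCDAG G
  field
    E⊆V×V   : ∀ u v → Edge G u v → (u ∈ V) × (v ∈ V)
    acyclic : ∀ v → ¬ TransClosure (Edge G) v v
    I⊆V     : ∀ v → v ∈ I → v ∈ V
    I-src   : ∀ u v → Edge G u v → v ∉ I
    O⊆V     : ∀ v → v ∈ O → v ∈ V

record CDAG (n : ℕ) : Set where
  constructor mkCDAG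
  field
    raw  : RawCDAG n
    isCDAG : IsCDAG raw

-- Induced sub-CDAG on the part i of a partition of V given by  part : Fin n → Fin p
-- (V_i = { v ∈ V | part v = i }); I_i = I ∩ V_i, E_i = E ∩ (V_i × V_i), O_i = O ∩ V_i.
partSet : ∀ {n p} → Subset n → (Fin n → Fin p) → Fin p → Subset n
partSet V part i = tabulate (λ v → lookup V v ∧ ⌊ part v ≟ i ⌋)

sub : ∀ {n p} → RawCDAG n → (Fin n → Fin p) → Fin p → RawCDAG n
sub (mkRaw V E I O) part i =
  mkRaw Vi (λ u v → E u v ∧ (lookup Vi u ∧ lookup Vi v)) (I ∩ Vi) (O ∩ Vi)
  where Vi = partSet V part i

-- Game states: red pebbles, blue pebbles, and the set of vertices fired so far (by R3).
record State (n : ℕ) : Set where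
  constructor st
  field
    red blue fired : Subset n

data Step {n : ℕ} (G : RawCDAG n) : State n → State n → ℕ → Set where
  input   : ∀ {r b f} v → v ∈ RawCDAG.V G → v ∈ b →
            Step G (st r b f) (st (r [ v ]≔ inside) b f) 1
  output  : ∀ {r b f} v → v ∈ RawCDAG.V G → v ∈ r →
            Step G (st r b f) (st r (b [ v ]≔ inside) f) 1
  compute : ∀ {r b f} v → v ∈ RawCDAG.V G → v ∉ RawCDAG.I G →
            (∀ u → Edge G u v → u ∈ r) →
            Step G (st r b f) (st (r [ v ]≔ inside) b (f [ v ]≔ inside)) 0
  computeMove : ∀ {r b f} u v → v ∈ RawCDAG.V G → v ∉ RawCDAG.I G →
            (∀ w → Edge G w v → w ∈ r) → Edge G u v →
            Step G (st r b f) (st ((r [ u ]≔ outside) [ v ]≔ inside) b (f [ v ]≔ inside)) 0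
  delete  : ∀ {r b f} v → v ∈ RawCDAG.V G → v ∈ r →
            Step G (st r b f) (st (r [ v ]≔ outside) b f) 0

data Run {n : ℕ} (S : ℕ) (G : RawCDAG n) : State n → State n → ℕ → Set where
  done : ∀ {s} → Run S G s s 0
  step : ∀ {s s′ s″ c d} → Step G s s′ c → ∣ State.red s′ ∣ ≤ S →
         Run S G s′ s″ d → Run S G s s″ (c + d)

initial : ∀ {n} → RawCDAG n → State n
initial G = st ⊥ (RawCDAG.I G) ⊥

CompleteCalc : ∀ {n} → ℕ → RawCDAG n → ℕ → Set
CompleteCalc {n} S G c = Σ (State n) λ s →
  Run S G (initial G) s c
  × (∀ v → v ∈ RawCDAG.V G → v ∉ RawCDAG.I G → v ∈ State.fired s)
  × (∀ v → v ∈ RawCDAG.O G → v ∈ State.blue s)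

IsIOComplexity : ∀ {n} → ℕ → RawCDAG n → ℕ → Set
IsIOComplexity S G q = CompleteCalc S G q × (∀ c → CompleteCalc S G c → q ≤ c)

IsIOLowerBound : ∀ {n} → ℕ → RawCDAG n → ℕ → Set
IsIOLowerBound S G L = ∀ c → CompleteCalc S G c → L ≤ c

module Submission where

-- Restricting every pebble set of a game state to V_i turns a run of the
-- red-blue pebble game on C into a run on the induced sub-CDAG C_i: a move on
-- a vertex outside V_i becomes no move at all, a move inside V_i becomes the
-- same move (a "move-compute" whose source predecessor lies outside V_i
-- becomes a plain compute, one whose target lies outside becomes a delete),
-- and the restriction never uses more red pebbles than the original run.  An
-- I/O move of C is charged to the unique block containing its vertex, so the
-- costs of the restricted runs sum to at most the cost of the original run.
-- Restricting a complete calculation of C therefore yields complete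
-- calculations of all C_i whose costs add up to at most its cost; this gives
-- both the lower-bound statement and  Σ Q_i ≤ Q.
--
-- None of it needs the CDAG axioms, so everything is stated for raw graphs.

open import Defs
open import Data.Nat using (ℕ; zero; suc; _≤_; _+_; z≤n)
open import Data.Nat.Properties
  using (≤-refl; ≤-trans; ≤-reflexive; +-mono-≤; +-assoc; +-identityʳ; +-commutativeSemigroup)
open import Algebra.Properties.CommutativeSemigroup +-commutativeSemigroup
  using (interchange)
open import Data.Fin using (Fin; _≟_) renaming (zero to fzero; suc to fsuc)
open import Data.Fin.Properties using (suc-injective)
open import Data.Vec using (sum; tabulate; lookup; _[_]≔_)
open import Data.Vec.Properties
  using (lookup∘update; lookup∘update′; lookup-zipWith; lookup∘tabulate;
         tabulate∘lookup; tabulate-cong; []=⇒lookup; lookup⇒[]=)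
open import Data.Fin.Subset using (Subset; _∈_; _∉_; _∩_; inside; outside; ∣_∣)
open import Data.Fin.Subset.Properties using (∣p∩q∣≤∣p∣; x∈p∩q⁺; x∈p∩q⁻; ∩-zeroˡ)
open import Data.Bool using (true; false; _∧_; if_then_else_)
open import Data.Bool.Properties using (∧-zeroʳ; ∧-identityʳ; ∧-conicalˡ)
open import Data.Product using (_×_; _,_; Σ; proj₁; proj₂)
open import Function using (_∘_)
open import Relation.Binary.PropositionalEquality
open import Relation.Nullary using (yes; no)
open import Relation.Nullary.Decidable using (⌊_⌋; isYes≗does; dec-false)
open ≡-Reasoning

sum-tabulate-zero : ∀ p → sum (tabulate {p} (λ _ → 0)) ≡ 0
sum-tabulate-zero zero    = refl
sum-tabulate-zero (suc p) = sum-tabulate-zero p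

sum-tabulate-+ : ∀ {p} (f g : Fin p → ℕ) →
  sum (tabulate (λ i → f i + g i)) ≡ sum (tabulate f) + sum (tabulate g)
sum-tabulate-+ {zero}  f g = refl
sum-tabulate-+ {suc p} f g = begin
  (f fzero + g fzero) + sum (tabulate (λ i → f (fsuc i) + g (fsuc i)))
    ≡⟨ cong ((f fzero + g fzero) +_) (sum-tabulate-+ (f ∘ fsuc) (g ∘ fsuc)) ⟩
  (f fzero + g fzero) + (sum (tabulate (f ∘ fsuc)) + sum (tabulate (g ∘ fsuc)))
    ≡⟨ interchange (f fzero) (g fzero) _ _ ⟩
  (f fzero + sum (tabulate (f ∘ fsuc))) + (g fzero + sum (tabulate (g ∘ fsuc)))  ∎

sum-tabulate-mono : ∀ {p} {f g : Fin p → ℕ} → (∀ i → f i ≤ g i) →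
  sum (tabulate f) ≤ sum (tabulate g)
sum-tabulate-mono {zero}  f≤g = z≤n
sum-tabulate-mono {suc p} f≤g = +-mono-≤ (f≤g fzero) (sum-tabulate-mono (f≤g ∘ fsuc))

sum-tabulate-supported : ∀ {p} (j : Fin p) (f : Fin p → ℕ) →
  (∀ i → i ≢ j → f i ≡ 0) → sum (tabulate f) ≡ f j
sum-tabulate-supported {suc p} fzero f off = begin
  f fzero + sum (tabulate (f ∘ fsuc))  ≡⟨ cong (f fzero +_) rest-vanishes ⟩
  f fzero + 0                          ≡⟨ +-identityʳ (f fzero) ⟩
  f fzero                              ∎
  where
  rest-vanishes : sum (tabulate (f ∘ fsuc)) ≡ 0
  rest-vanishes = trans (cong sum (tabulate-cong (λ i → off (fsuc i) (λ ())))) (sum-tabulate-zero p)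
sum-tabulate-supported {suc p} (fsuc j) f off = begin
  f fzero + sum (tabulate (f ∘ fsuc))  ≡⟨ cong (_+ sum (tabulate (f ∘ fsuc))) (off fzero (λ ())) ⟩
  sum (tabulate (f ∘ fsuc))            ≡⟨ sum-tabulate-supported j (f ∘ fsuc) (λ i i≢j → off (fsuc i) (i≢j ∘ suc-injective)) ⟩
  f (fsuc j)                           ∎

subset-ext : ∀ {n} (p q : Subset n) → (∀ v → lookup p v ≡ lookup q v) → p ≡ q
subset-ext p q same = begin
  p                   ≡⟨ tabulate∘lookup p ⟨
  tabulate (lookup p) ≡⟨ tabulate-cong same ⟩
  tabulate (lookup q) ≡⟨ tabulate∘lookup q ⟩
  q                   ∎

lookup-∩ : ∀ {n} (p q : Subset n) v → lookup (p ∩ q) v ≡ lookup p v ∧ lookup q v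
lookup-∩ p q v = lookup-zipWith _∧_ v p q

lookup-update-∩-≢ : ∀ {n} (x W : Subset n) {v k} a → v ≢ k →
  lookup ((x [ v ]≔ a) ∩ W) k ≡ lookup (x ∩ W) k
lookup-update-∩-≢ x W {v} {k} a v≢k = begin
  lookup ((x [ v ]≔ a) ∩ W) k        ≡⟨ lookup-∩ (x [ v ]≔ a) W k ⟩
  lookup (x [ v ]≔ a) k ∧ lookup W k ≡⟨ cong (_∧ lookup W k) (lookup∘update′ (v≢k ∘ sym) x a) ⟩
  lookup x k ∧ lookup W k            ≡⟨ lookup-∩ x W k ⟨
  lookup (x ∩ W) k                   ∎

update-∩-inside : ∀ {n} (x W : Subset n) {v} a → lookup W v ≡ true →
  (x [ v ]≔ a) ∩ W ≡ (x ∩ W) [ v ]≔ a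
update-∩-inside x W {v} a v∈W = subset-ext _ _ pointwise
  where
  pointwise : ∀ k → lookup ((x [ v ]≔ a) ∩ W) k ≡ lookup ((x ∩ W) [ v ]≔ a) k
  pointwise k with v ≟ k
  ... | yes refl = begin
    lookup ((x [ v ]≔ a) ∩ W) v        ≡⟨ lookup-∩ (x [ v ]≔ a) W v ⟩
    lookup (x [ v ]≔ a) v ∧ lookup W v ≡⟨ cong₂ _∧_ (lookup∘update v x a) v∈W ⟩
    a ∧ true                           ≡⟨ ∧-identityʳ a ⟩
    a                                  ≡⟨ lookup∘update v (x ∩ W) a ⟨
    lookup ((x ∩ W) [ v ]≔ a) v        ∎
  ... | no v≢k = trans (lookup-update-∩-≢ x W a v≢k) (sym (lookup∘update′ (v≢k ∘ sym) (x ∩ W) a))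

update-∩-outside : ∀ {n} (x W : Subset n) {v} a → lookup W v ≡ false →
  (x [ v ]≔ a) ∩ W ≡ x ∩ W
update-∩-outside x W {v} a v∉W = subset-ext _ _ pointwise
  where
  pointwise : ∀ k → lookup ((x [ v ]≔ a) ∩ W) k ≡ lookup (x ∩ W) k
  pointwise k with v ≟ k
  ... | yes refl = begin
    lookup ((x [ v ]≔ a) ∩ W) v        ≡⟨ lookup-∩ (x [ v ]≔ a) W v ⟩
    lookup (x [ v ]≔ a) v ∧ lookup W v ≡⟨ cong (lookup (x [ v ]≔ a) v ∧_) v∉W ⟩
    lookup (x [ v ]≔ a) v ∧ false      ≡⟨ ∧-zeroʳ _ ⟩
    false                              ≡⟨ ∧-zeroʳ _ ⟨
    lookup x v ∧ false                 ≡⟨ cong (lookup x v ∧_) v∉W ⟨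
    lookup x v ∧ lookup W v            ≡⟨ lookup-∩ x W v ⟨
    lookup (x ∩ W) v                   ∎
  ... | no v≢k = lookup-update-∩-≢ x W a v≢k

partSet⊆ : ∀ {n p} (V : Subset n) (part : Fin n → Fin p) {i v} → v ∈ partSet V part i → v ∈ V
partSet⊆ V part {i} {v} v∈Vᵢ =
  lookup⇒[]= v V (∧-conicalˡ _ _ (trans (sym (lookup∘tabulate _ v)) ([]=⇒lookup v∈Vᵢ)))

lookup-partSet-≢ : ∀ {n p} (V : Subset n) (part : Fin n → Fin p) {i} v → part v ≢ i →
  lookup (partSet V part i) v ≡ false
lookup-partSet-≢ V part {i} v v∉i = begin
  lookup (partSet V part i) v       ≡⟨ lookup∘tabulate _ v ⟩
  lookup V v ∧ ⌊ part v ≟ i ⌋       ≡⟨ cong (lookup V v ∧_) (trans (isYes≗does (part v ≟ i)) (dec-false (part v ≟ i) v∉i)) ⟩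
  lookup V v ∧ false                ≡⟨ ∧-zeroʳ _ ⟩
  false                             ∎

restrict : ∀ {n} → Subset n → State n → State n
restrict W (st r b f) = st (r ∩ W) (b ∩ W) (f ∩ W)

st-cong : ∀ {n} {r r′ b b′ f f′ : Subset n} → r ≡ r′ → b ≡ b′ → f ≡ f′ → st r b f ≡ st r′ b′ f′
st-cong refl refl refl = refl

_++ᴿ_ : ∀ {n S} {G : RawCDAG n} {s t u c d} → Run S G s t c → Run S G t u d → Run S G s u (c + d)
done ++ᴿ run = run
step {c = c} {d = d} move bound rest ++ᴿ run =
  subst (Run _ _ _ _) (sym (+-assoc c d _)) (step move bound (rest ++ᴿ run))

module Restriction {n p : ℕ} (G : RawCDAG n) (part : Fin n → Fin p) (S : ℕ) where
  open RawCDAG G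

  block : Fin p → Subset n
  block i = partSet V part i

  Gᵢ : Fin p → RawCDAG n
  Gᵢ i = sub G part i

  inBlock : ∀ i {v} → lookup (block i) v ≡ true → v ∈ block i
  inBlock i {v} = lookup⇒[]= v (block i)

  restrict-initial : ∀ i → restrict (block i) (initial G) ≡ initial (Gᵢ i)
  restrict-initial i = cong (λ e → st e (I ∩ block i) e) (∩-zeroˡ (block i))

  sub-edge⁻ : ∀ i {u v} → Edge (Gᵢ i) u v → Edge G u v × u ∈ block i
  sub-edge⁻ i {u} {v} e with E u v | lookup (block i) u in u∈Vᵢ
  ... | true  | true  = _ , inBlock i u∈Vᵢ
  sub-edge⁻ i () | true | false
  sub-edge⁻ i () | false | _

  sub-edge⁺ : ∀ i {u v} → Edge G u v → lookup (block i) u ≡ true → lookup (block i) v ≡ true →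
    Edge (Gᵢ i) u v
  sub-edge⁺ i {u} {v} e u∈Vᵢ v∈Vᵢ rewrite u∈Vᵢ | v∈Vᵢ | ∧-identityʳ (E u v) = e

  charge : Fin n → ℕ → Fin p → ℕ
  charge v c i = if lookup (block i) v then c else 0

  -- Only the block containing  v  is charged, so the total charge is at most  c.
  sum-charge : ∀ v c → sum (tabulate (charge v c)) ≤ c
  sum-charge v c = ≤-trans (≤-reflexive (sum-tabulate-supported (part v) (charge v c) elsewhere))
                           (if-≤ (lookup (block (part v)) v))
    where
    elsewhere : ∀ i → i ≢ part v → charge v c i ≡ 0
    elsewhere i i≢ = cong (if_then c else 0) (lookup-partSet-≢ V part v (i≢ ∘ sym))
    if-≤ : ∀ b → (if b then c else 0) ≤ c
    if-≤ true  = ≤-refl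
    if-≤ false = z≤n

  touched : ∀ {s s′ c} → Step G s s′ c → Fin n
  touched (input v _ _)             = v
  touched (output v _ _)            = v
  touched (compute v _ _ _)         = v
  touched (computeMove _ v _ _ _ _) = v
  touched (delete v _ _)            = v

  oneMove : ∀ i {s t s′ c} → Step (Gᵢ i) s t c → t ≡ restrict (block i) s′ → ∣ State.red s′ ∣ ≤ S →
    Run S (Gᵢ i) s (restrict (block i) s′) (c + 0)
  oneMove i {s′ = s′} move refl bound = step move (≤-trans (∣p∩q∣≤∣p∣ (State.red s′) (block i)) bound) done

  noMove : ∀ i {s t} → t ≡ s → Run S (Gᵢ i) s t 0
  noMove i refl = done

  notInput : ∀ i {v} → v ∉ I → v ∉ I ∩ block i
  notInput i v∉I v∈Iᵢ = v∉I (proj₁ (x∈p∩q⁻ I (block i) v∈Iᵢ))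

  predsRed : ∀ i {r v} → (∀ u → Edge G u v → u ∈ r) → ∀ u → Edge (Gᵢ i) u v → u ∈ r ∩ block i
  predsRed i preds u e with sub-edge⁻ i e
  ... | e′ , u∈Vᵢ = x∈p∩q⁺ (preds u e′ , u∈Vᵢ)

  restrictStep : ∀ i {s s′ c} (move : Step G s s′ c) → ∣ State.red s′ ∣ ≤ S →
    Run S (Gᵢ i) (restrict (block i) s) (restrict (block i) s′) (charge (touched move) c i)
  restrictStep i (input {r} v _ v∈b) bound with lookup (block i) v in v∈Vᵢ
  ... | true  = oneMove i (input v (inBlock i v∈Vᵢ) (x∈p∩q⁺ (v∈b , inBlock i v∈Vᵢ)))
                  (st-cong (sym (update-∩-inside r (block i) inside v∈Vᵢ)) refl refl) bound
  ... | false = noMove i (st-cong (update-∩-outside r (block i) inside v∈Vᵢ) refl refl)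
  restrictStep i (output {b = b} v _ v∈r) bound with lookup (block i) v in v∈Vᵢ
  ... | true  = oneMove i (output v (inBlock i v∈Vᵢ) (x∈p∩q⁺ (v∈r , inBlock i v∈Vᵢ)))
                  (st-cong refl (sym (update-∩-inside b (block i) inside v∈Vᵢ)) refl) bound
  ... | false = noMove i (st-cong refl (update-∩-outside b (block i) inside v∈Vᵢ) refl)
  restrictStep i (compute {r} {f = f} v _ v∉I preds) bound with lookup (block i) v in v∈Vᵢ
  ... | true  = oneMove i (compute v (inBlock i v∈Vᵢ) (notInput i v∉I) (predsRed i preds))
                  (st-cong (sym (update-∩-inside r (block i) inside v∈Vᵢ)) refl
                           (sym (update-∩-inside f (block i) inside v∈Vᵢ))) bound
  ... | false = noMove i (st-cong (update-∩-outside r (block i) inside v∈Vᵢ) refl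
                                  (update-∩-outside f (block i) inside v∈Vᵢ))
  restrictStep i (computeMove {r} {f = f} u v _ v∉I preds e) bound
    with lookup (block i) u in u∈Vᵢ | lookup (block i) v in v∈Vᵢ
  ... | true  | true  = oneMove i
          (computeMove u v (inBlock i v∈Vᵢ) (notInput i v∉I) (predsRed i preds)
                       (sub-edge⁺ i e u∈Vᵢ v∈Vᵢ))
          (st-cong (sym (trans (update-∩-inside (r [ u ]≔ outside) (block i) inside v∈Vᵢ)
                               (cong (_[ v ]≔ inside) (update-∩-inside r (block i) outside u∈Vᵢ))))
                   refl (sym (update-∩-inside f (block i) inside v∈Vᵢ))) bound
  ... | false | true  = oneMove i
          (compute v (inBlock i v∈Vᵢ) (notInput i v∉I) (predsRed i preds))
          (st-cong (sym (trans (update-∩-inside (r [ u ]≔ outside) (block i) inside v∈Vᵢ)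
                               (cong (_[ v ]≔ inside) (update-∩-outside r (block i) outside u∈Vᵢ))))
                   refl (sym (update-∩-inside f (block i) inside v∈Vᵢ))) bound
  ... | true  | false = oneMove i
          (delete u (inBlock i u∈Vᵢ) (x∈p∩q⁺ (preds u e , inBlock i u∈Vᵢ)))
          (st-cong (sym (trans (update-∩-outside (r [ u ]≔ outside) (block i) inside v∈Vᵢ)
                               (update-∩-inside r (block i) outside u∈Vᵢ)))
                   refl (sym (update-∩-outside f (block i) inside v∈Vᵢ))) bound
  ... | false | false = noMove i
          (st-cong (trans (update-∩-outside (r [ u ]≔ outside) (block i) inside v∈Vᵢ)
                          (update-∩-outside r (block i) outside u∈Vᵢ))
                   refl (update-∩-outside f (block i) inside v∈Vᵢ))
  restrictStep i (delete {r} v _ v∈r) bound with lookup (block i) v in v∈Vᵢ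
  ... | true  = oneMove i (delete v (inBlock i v∈Vᵢ) (x∈p∩q⁺ (v∈r , inBlock i v∈Vᵢ)))
                  (st-cong (sym (update-∩-inside r (block i) outside v∈Vᵢ)) refl refl) bound
  ... | false = noMove i (st-cong (update-∩-outside r (block i) outside v∈Vᵢ) refl refl)

  restrictRun : ∀ {s s′ c} → Run S G s s′ c → Σ (Fin p → ℕ) λ cs →
    (∀ i → Run S (Gᵢ i) (restrict (block i) s) (restrict (block i) s′) (cs i))
    × sum (tabulate cs) ≤ c
  restrictRun done = (λ _ → 0) , (λ _ → done) , ≤-reflexive (sum-tabulate-zero p)
  restrictRun (step {c = c} move bound rest) with restrictRun rest
  ... | cs , runs , cost =
    (λ i → charge (touched move) c i + cs i) ,
    (λ i → restrictStep i move bound ++ᴿ runs i) ,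
    ≤-trans (≤-reflexive (sum-tabulate-+ (charge (touched move) c) cs))
            (+-mono-≤ (sum-charge (touched move) c) cost)

  restrictCalc : ∀ {c} → CompleteCalc S G c → Σ (Fin p → ℕ) λ cs →
    (∀ i → CompleteCalc S (Gᵢ i) (cs i)) × sum (tabulate cs) ≤ c
  restrictCalc (s , run , allFired , outputsBlue) with restrictRun run
  ... | cs , runs , cost = cs , calc , cost
    where
    calc : ∀ i → CompleteCalc S (Gᵢ i) (cs i)
    calc i = restrict (block i) s
           , subst (λ s₀ → Run S (Gᵢ i) s₀ (restrict (block i) s) (cs i)) (restrict-initial i) (runs i)
           , (λ v v∈Vᵢ v∉Iᵢ → x∈p∩q⁺ (allFired v (partSet⊆ V part v∈Vᵢ)
                                         (λ v∈I → v∉Iᵢ (x∈p∩q⁺ (v∈I , v∈Vᵢ))) , v∈Vᵢ))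
           , (λ v v∈Oᵢ → let v∈O , v∈Vᵢ = x∈p∩q⁻ O (block i) v∈Oᵢ in x∈p∩q⁺ (outputsBlue v v∈O , v∈Vᵢ))

  lowerBound-sum : (L : Fin p → ℕ) → (∀ i → IsIOLowerBound S (Gᵢ i) (L i)) →
    IsIOLowerBound S G (sum (tabulate L))
  lowerBound-sum L bounds c calc with restrictCalc calc
  ... | cs , calcs , cost = ≤-trans (sum-tabulate-mono (λ i → bounds i (cs i) (calcs i))) cost

open Restriction using (lowerBound-sum)

theorem2 : ∀ {n p : ℕ} (C : CDAG n) (S : ℕ) → 1 ≤ S → (part : Fin n → Fin p) →
    (∀ (Q : ℕ) (Qs : Fin p → ℕ) → IsIOComplexity S (CDAG.raw C) Q →
        (∀ i → IsIOComplexity S (sub (CDAG.raw C) part i) (Qs i)) →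
        sum (tabulate Qs) ≤ Q)
    × (∀ (L : Fin p → ℕ) → (∀ i → IsIOLowerBound S (sub (CDAG.raw C) part i) (L i)) →
        IsIOLowerBound S (CDAG.raw C) (sum (tabulate L)))
theorem2 {n} {p} C S _ part = complexity-sum , lowerBound-sum G part S
  where
  G : RawCDAG n
  G = CDAG.raw C
  -- The complexities  Qᵢ  are lower bounds, and  Q  is the cost of a complete calculation.
  complexity-sum : ∀ Q Qs → IsIOComplexity S G Q → (∀ i → IsIOComplexity S (sub G part i) (Qs i)) →
    sum (tabulate Qs) ≤ Q
  complexity-sum Q Qs (calc , _) optimal = lowerBound-sum G part S Qs (λ i → proj₂ (optimal i)) Q calc
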